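{- Let $\mathcal{G}=(G,\lambda)$ be a simple temporal clique with $G=(V,E)$, and let $E^-_T$ and the emitters be as defined below (for any of the arbitrary choices allowed). Then the forward fireworks cover $S^-_T=\{\{u,v\}: (u,v)\in E^-_T\}\cup\{\{u,v\}\in E : u \text{ is an emitter}\}$ is a temporal spanner of $\mathcal{G}$.
   Context: A simple temporal clique is a pair $\mathcal{G}=(G,\lambda)$ where $G=(V,E)$ is the complete graph on a finite vertex set $V$ with $|V|\ge 2$, and $\lambda:E\to\mathbb{N}$ assigns each edge a single label such that any two distinct edges sharing an endpoint have distinct labels. A journey from $x$ to $y$ is a sequence of edges $\{u_1,u_2\},\dots,\{u_k,u_{k+1}\}$ ($k\ge1$) with $u_1=x$, $u_{k+1}=y$, the $u_i$ pairwise distinct, and strictly increasing labels. A subset $E'\subseteq E$ is a temporal spanner of $\mathcal{G}$ if for every ordered pair of distinct vertices $x,y$ there is a journey from $x$ to $y$ using only edges of $E'$. For a vertex $v$, $e^-(v)$ denotes the edge incident to $v$ with the smallest label. Let $E^-$ be the set of arcs on $V$ containing, for each vertex $v$ with $e^-(v)=\{u,v\}$, the arc $(u,v)$, except that whenever $e^-(u)=e^-(v)$ only one of $(u,v),(v,u)$ is included (chosen arbitrarily). A sink of $E^-$ is a vertex of out-degree $0$ in $(V,E^-)$. $E^-_T$ is obtained from $E^-$ as follows: for every vertex $v$ of out-degree at least $2$ in $E^-$, let $(v,u_1),\dots,(v,u_\ell)$ be its out-arcs where $(v,u_\ell)$ has the largest label; for each $i<\ell$, if $u_i$ is a sink of $E^-$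 replace $(v,u_i)$ by $(u_i,v)$, otherwise delete $(v,u_i)$. The emitters are the vertices of out-degree $0$ in $(V,E^-_T)$. -}

module Defs where

open import Data.Nat using (ℕ; _<_)
open import Data.Fin using (Fin)
open import Data.List using (List; []; _∷_)
open import Data.List.Relation.Unary.Unique.Propositional using (Unique)
open import Data.Product using (Σ; ∃; ∃-syntax; _×_)
open import Data.Sum using (_⊎_)
open import Data.Empty using (⊥)
open import Relation.Nullary using (¬_)
open import Relation.Binary.PropositionalEquality using (_≡_; _≢_)

-- Vertex set V = Fin m; a labelling is given on ordered pairs, required to be symmetric.
-- The value on the diagonal (lab v v) is never used.
Labelling : ℕ → Set
Labelling m = Fin m → Fin m → ℕ

Symmetric : ∀ {m} → Labelling m → Set
Symmetric {m} lab = ∀ (u v : Fin m) → lab u v ≡ lab v u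

-- simple temporal clique: distinct edges {u,v},{u,w} sharing endpoint u get distinct labels
LocallyInjective : ∀ {m} → Labelling m → Set
LocallyInjective {m} lab =
  ∀ (u v w : Fin m) → u ≢ v → u ≢ w → v ≢ w → lab u v ≢ lab u w

-- e⁻(v) = {v,u} : u is the neighbour of v along the edge of smallest label at v
MinNbr : ∀ {m} → Labelling m → Fin m → Fin m → Set
MinNbr {m} lab v u = (u ≢ v) × (∀ (w : Fin m) → w ≢ v → w ≢ u → lab v u < lab v w)

-- A relation A (set of arcs) is a valid choice of E⁻:
--  * every arc (u,v) ∈ A has e⁻(v) = {u,v};
--  * if e⁻(v) = {u,v} and e⁻(u) ≠ e⁻(v), then (u,v) ∈ A;
--  * if e⁻(v) = e⁻(u) = {u,v}, exactly one of (u,v),(v,u) is in A.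
IsEMinus : ∀ {m} → Labelling m → (Fin m → Fin m → Set) → Set
IsEMinus {m} lab A =
  (∀ (u v : Fin m) → A u v → MinNbr lab v u) ×
  (∀ (u v : Fin m) → MinNbr lab v u → ¬ MinNbr lab u v → A u v) ×
  (∀ (u v : Fin m) → MinNbr lab v u → MinNbr lab u v → A u v ⊎ A v u) ×
  (∀ (u v : Fin m) → A u v → A v u → ⊥)

Sink : ∀ {m} → (Fin m → Fin m → Set) → Fin m → Set
Sink {m} A v = ∀ (w : Fin m) → ¬ A v w

MaxOut : ∀ {m} → Labelling m → (Fin m → Fin m → Set) → Fin m → Fin m → Set
MaxOut {m} lab A x y = ∀ (w : Fin m) → A x w → w ≢ y → lab x w < lab x y

-- E⁻_T: an arc (x,y) of E⁻ is kept iff y is the largest-label out-neighbour of x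
-- (this includes the out-degree-1 case); a non-largest out-arc (y,x) of y is
-- reversed to (x,y) if x is a sink of E⁻, otherwise deleted.
ETMinus : ∀ {m} → Labelling m → (Fin m → Fin m → Set) → Fin m → Fin m → Set
ETMinus {m} lab A x y =
  (A x y × MaxOut lab A x y) ⊎
  (A y x × (∃[ w ] (A y w × lab y x < lab y w)) × Sink A x)

Emitter : ∀ {m} → Labelling m → (Fin m → Fin m → Set) → Fin m → Set
Emitter lab A v = ∀ w → ¬ ETMinus lab A v w

-- forward fireworks cover S⁻_T as a (symmetric) edge relation
ForwardCover : ∀ {m} → Labelling m → (Fin m → Fin m → Set) → Fin m → Fin m → Set
ForwardCover lab A u v =
  ETMinus lab A u v ⊎ ETMinus lab A v u ⊎
  ((u ≢ v) × (Emitter lab A u ⊎ Emitter lab A v))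

-- Walk S lab x y vs t : a walk from x to y using edges of S with strictly increasing
-- labels, last edge label t, visiting the vertices vs (listed in reverse order).
data Walk {m} (S : Fin m → Fin m → Set) (lab : Labelling m)
          : Fin m → Fin m → List (Fin m) → ℕ → Set where
  one  : ∀ {x y} → S x y → x ≢ y → Walk S lab x y (y ∷ x ∷ []) (lab x y)
  step : ∀ {x y z vs t} → Walk S lab x y vs t → S y z → t < lab y z →
         Walk S lab x z (z ∷ vs) (lab y z)

Journey : ∀ {m} → (Fin m → Fin m → Set) → Labelling m → Fin m → Fin m → Set
Journey S lab x y = ∃[ vs ] ∃[ t ] (Walk S lab x y vs t × Unique vs)

TemporalSpanner : ∀ {m} → Labelling m → (Fin m → Fin m → Set) → Set
TemporalSpanner {m} lab S = ∀ (x y : Fin m) → x ≢ y → Journey S lab x y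

-- Follow arcs of E⁻_T starting from x.  Consecutive arcs of E⁻_T have increasing labels,
-- so this is a temporal walk, and it must stop since labels are bounded.  Either it meets
-- y, or it stops at an emitter v.  The last arc (u,v) then lies in E⁻ (otherwise v would
-- have an out-arc of E⁻ and hence its largest one in E⁻_T), so {u,v} = e⁻(v) is the first
-- edge at v and the walk can be finished by the emitter edge {v,y}.  Removing loops
-- turns the walk into a journey.
module Submission where

open import Defs
open import Data.Nat using (ℕ; suc; zero; _<_; _≤_; _∸_; _⊔_)
open import Data.Nat.Properties
  using (≤-refl; ≤-trans; <⇒≤; ≤-<-trans; <-trans; <-irrefl; <-asym; _<?_; ≮⇒≥; ≤∧≢⇒<;
         ∸-monoʳ-<; m≤m⊔n; m≤n⇒m≤o⊔n)
open import Data.Nat.Induction using (<-wellFounded)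
open import Data.Fin using (Fin) renaming (zero to fzero; suc to fsuc)
open import Data.Fin.Properties using (any?; all?; _≟_)
open import Data.List using (_∷_)
open import Data.List.Relation.Unary.Any using (here; there)
open import Data.List.Relation.Unary.All using ([]; _∷_)
open import Data.List.Relation.Unary.AllPairs using ([]; _∷_)
open import Data.List.Relation.Unary.All.Properties.Core using (¬Any⇒All¬)
open import Data.List.Relation.Unary.Unique.Propositional using (Unique)
open import Data.List.Membership.Propositional using (_∈_)
open import Data.List.Membership.DecPropositional using () renaming (_∈?_ to member?)
open import Data.Product using (∃-syntax; _×_; _,_; proj₁; proj₂)
open import Data.Sum using (_⊎_; inj₁; inj₂)
import Data.Sum as Sum
open import Function using (_∘_)
open import Induction.WellFounded using (Acc; acc)
open import Relation.Nullary using (¬_; Dec; yes; no; contradiction)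
open import Relation.Nullary.Decidable using (_×-dec_; _⊎-dec_; _→-dec_; ¬?)
open import Relation.Unary using (Decidable)
open import Relation.Binary.PropositionalEquality using (_≡_; _≢_; refl; sym; subst; ≢-sym)

bounded : ∀ {k} (f : Fin k → ℕ) → ∃[ B ] (∀ i → f i ≤ B)
bounded {zero} f = 0 , λ ()
bounded {suc k} f with bounded (f ∘ fsuc)
... | B , f≤B = f fzero ⊔ B , λ { fzero → m≤m⊔n _ _ ; (fsuc i) → m≤n⇒m≤o⊔n (f fzero) (f≤B i) }

labelling-bounded : ∀ {m} (lab : Labelling m) → ∃[ B ] (∀ u v → lab u v ≤ B)
labelling-bounded lab with bounded (proj₁ ∘ bounded ∘ lab)
... | B , row≤B = B , λ u v → ≤-trans (proj₂ (bounded (lab u)) v) (row≤B u)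

module _ {k} {P : Fin k → Set} (P? : Decidable P) (f : Fin k → ℕ)
         (f-injective : ∀ {i j} → P i → P j → i ≢ j → f i ≢ f j) where

  maximum-exists : ∀ {i} → P i → ∃[ j ] (P j × ∀ i → P i → i ≢ j → f i < f j)
  maximum-exists Pi = climb Pi (<-wellFounded _)
    where
    B = proj₁ (bounded f)

    climb : ∀ {i} → P i → Acc _<_ (B ∸ f i) → ∃[ j ] (P j × ∀ i → P i → i ≢ j → f i < f j)
    climb {i} Pi (acc rs) with any? (λ j → P? j ×-dec (f i <? f j))
    ... | yes (j , Pj , fi<fj) = climb Pj (rs (∸-monoʳ-< fi<fj (proj₂ (bounded f) j)))
    ... | no ¬higher = i , Pi , λ j Pj j≢i →
          ≤∧≢⇒< (≮⇒≥ (λ fi<fj → ¬higher (j , Pj , fi<fj))) (f-injective Pj Pi j≢i)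

module _ {m} {S : Fin m → Fin m → Set} {lab : Labelling m} where

  TemporalWalk : Fin m → Fin m → Set
  TemporalWalk x y = ∃[ vs ] ∃[ t ] Walk S lab x y vs t

  JourneyBy : Fin m → Fin m → ℕ → Set
  JourneyBy x y t = ∃[ vs ] ∃[ t′ ] (Walk S lab x y vs t′ × Unique vs × t′ ≤ t)

  journeyBy-mono : ∀ {x y t t′} → t ≤ t′ → JourneyBy x y t → JourneyBy x y t′
  journeyBy-mono t≤t′ (vs , s , W , u , s≤t) = vs , s , W , u , ≤-trans s≤t t≤t′

  journeyBy-edge : ∀ {x y} → S x y → x ≢ y → JourneyBy x y (lab x y)
  journeyBy-edge s x≢y = _ , _ , one s x≢y , (≢-sym x≢y ∷ []) ∷ [] ∷ [] , ≤-refl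

  journeyBy-prefix : ∀ {x y z vs t} → Walk S lab x y vs t → Unique vs → z ∈ vs →
                     z ≡ x ⊎ JourneyBy x z t
  journeyBy-prefix W@(one _ _) u (here refl) = inj₂ (_ , _ , W , u , ≤-refl)
  journeyBy-prefix (one _ _) _ (there (here refl)) = inj₁ refl
  journeyBy-prefix (one _ _) _ (there (there ()))
  journeyBy-prefix W@(step _ _ _) u (here refl) = inj₂ (_ , _ , W , u , ≤-refl)
  journeyBy-prefix (step W _ t<) (_ ∷ u) (there z∈) =
    Sum.map₂ (journeyBy-mono (<⇒≤ t<)) (journeyBy-prefix W u z∈)

  journeyBy-snoc : ∀ {x y z t} → x ≡ y ⊎ JourneyBy x y t → S y z → t < lab y z →
                   x ≡ z ⊎ JourneyBy x z (lab y z)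
  journeyBy-snoc {x} {z = z} (inj₁ refl) s _ with x ≟ z
  ... | yes x≡z = inj₁ x≡z
  ... | no x≢z = inj₂ (journeyBy-edge s x≢z)
  journeyBy-snoc {z = z} (inj₂ (vs , t′ , W , u , t′≤t)) s t< with member? _≟_ z vs
  ... | yes z∈ = Sum.map sym (journeyBy-mono (<⇒≤ (≤-<-trans t′≤t t<))) (journeyBy-prefix W u z∈)
  ... | no z∉ = inj₂ (_ , _ , step W s (≤-<-trans t′≤t t<) , ¬Any⇒All¬ vs z∉ ∷ u , ≤-refl)

  walk⇒journeyBy : ∀ {x y vs t} → Walk S lab x y vs t → x ≡ y ⊎ JourneyBy x y t
  walk⇒journeyBy (one s x≢y) = inj₂ (journeyBy-edge s x≢y)
  walk⇒journeyBy (step W s t<) = journeyBy-snoc (walk⇒journeyBy W) s t<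

  walk⇒journey : ∀ {x y} → x ≢ y → TemporalWalk x y → Journey S lab x y
  walk⇒journey x≢y (_ , _ , W) with walk⇒journeyBy W
  ... | inj₁ x≡y = contradiction x≡y x≢y
  ... | inj₂ (vs , t , W′ , u , _) = vs , t , W′ , u

  walk-head : ∀ {x y w vs t} → Walk S lab x y (w ∷ vs) t → w ≡ y
  walk-head (one _ _) = refl
  walk-head (step _ _ _) = refl

  walk-init : ∀ {x u v vs t} → Walk S lab x v (v ∷ u ∷ vs) t → u ≡ x ⊎ TemporalWalk x u
  walk-init (one _ _) = inj₁ refl
  walk-init (step W _ _) with walk-head W
  ... | refl = inj₂ (_ , _ , W)

minNbr? : ∀ {m} (lab : Labelling m) v u → Dec (MinNbr lab v u)
minNbr? lab v u =
  ¬? (u ≟ v) ×-dec all? (λ w → ¬? (w ≟ v) →-dec (¬? (w ≟ u) →-dec (lab v u <? lab v w)))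

module FireworksCover {m} {lab : Labelling m} (symm : Symmetric lab) (linj : LocallyInjective lab)
                      {A : Fin m → Fin m → Set} (isE : IsEMinus lab A) where

  private
    S = ForwardCover lab A

  A⇒minNbr : ∀ {u v} → A u v → MinNbr lab v u
  A⇒minNbr = proj₁ isE _ _

  A-irreflexive : ∀ {u v} → A u v → u ≢ v
  A-irreflexive = proj₁ ∘ A⇒minNbr

  A-asym : ∀ {u v} → A u v → ¬ A v u
  A-asym = proj₂ (proj₂ (proj₂ isE)) _ _

  A-dec : ∀ u v → Dec (A u v)
  A-dec u v with minNbr? lab v u | minNbr? lab u v
  ... | no ¬min | _ = no (¬min ∘ A⇒minNbr)
  ... | yes min | no ¬min′ = yes (proj₁ (proj₂ isE) u v min ¬min′)
  ... | yes min | yes min′ with proj₁ (proj₂ (proj₂ isE)) u v min min′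
  ...   | inj₁ Auv = yes Auv
  ...   | inj₂ Avu = no (λ Auv → A-asym Auv Avu)

  etMinus? : ∀ x y → Dec (ETMinus lab A x y)
  etMinus? x y =
    (A-dec x y ×-dec maxOut?) ⊎-dec
    (A-dec y x ×-dec any? (λ w → A-dec y w ×-dec (lab y x <? lab y w)) ×-dec sink?)
    where
    maxOut? = all? λ w → A-dec x w →-dec (¬? (w ≟ y) →-dec (lab x w <? lab x y))
    sink? = all? (λ w → ¬? (A-dec x w))

  maxOut-exists : ∀ {v w} → A v w → ∃[ z ] (A v z × MaxOut lab A v z)
  maxOut-exists {v} = maximum-exists (A-dec v) (lab v)
    (λ Avi Avj → linj v _ _ (A-irreflexive Avi) (A-irreflexive Avj))

  etMinus-irreflexive : ∀ {u v} → ETMinus lab A u v → u ≢ v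
  etMinus-irreflexive (inj₁ (Auv , _)) = A-irreflexive Auv
  etMinus-irreflexive (inj₂ (Avu , _)) = ≢-sym (A-irreflexive Avu)

  -- (u,v) ∈ E⁻ means {u,v} = e⁻(v).
  A-lab-minimal : ∀ {u v w} → A u v → w ≢ v → w ≢ u → lab u v < lab v w
  A-lab-minimal {u} {v} {w} Auv w≢v w≢u =
    subst (_< lab v w) (symm v u) (proj₂ (A⇒minNbr Auv) _ w≢v w≢u)

  etMinus-increasing : ∀ {u v z} → ETMinus lab A u v → ETMinus lab A v z → lab u v < lab v z
  etMinus-increasing {u} {v} {z} (inj₁ (Auv , max)) vz with z ≟ u
  ... | no z≢u = A-lab-minimal Auv (≢-sym (etMinus-irreflexive vz)) z≢u
  etMinus-increasing (inj₁ (Auv , _)) (inj₁ (Avu , _)) | yes refl = contradiction Avu (A-asym Auv)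
  etMinus-increasing (inj₁ (Auv , max)) (inj₂ (_ , (w , Auw , uv<uw) , _)) | yes refl =
    contradiction (max w Auw (λ { refl → <-irrefl refl uv<uw })) (<-asym uv<uw)
  etMinus-increasing (inj₂ (Avu , _)) (inj₂ (_ , _ , sink-v)) = contradiction Avu (sink-v _)
  etMinus-increasing {u} {v} {z} (inj₂ (Avu , (w , Avw , vu<vw) , _)) (inj₁ (Avz , max)) =
    subst (_< lab v z) (symm v u) (vu<vz (w ≟ z))
    where
    vu<vz : Dec (w ≡ z) → lab v u < lab v z
    vu<vz (yes refl) = vu<vw
    vu<vz (no w≢z) = <-trans vu<vw (max w Avw w≢z)

  -- A reversed arc (u,v) of E⁻_T comes from an arc (v,u) of E⁻, so v is not an emitter.
  arc-into-emitter : ∀ {u v} → ETMinus lab A u v → Emitter lab A v → A u v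
  arc-into-emitter (inj₁ (Auv , _)) _ = Auv
  arc-into-emitter (inj₂ (Avu , _)) emitter with maxOut-exists Avu
  ... | z , Avz , max = contradiction (inj₁ (Avz , max)) (emitter z)

  private
    B = proj₁ (labelling-bounded lab)
    lab≤B = proj₂ (labelling-bounded lab)

  chase : ∀ {x y u v rest} → x ≢ y → ETMinus lab A u v →
          Walk S lab x v (v ∷ u ∷ rest) (lab u v) → Acc _<_ (B ∸ lab u v) → TemporalWalk x y
  chase {x} {y} {u} {v} x≢y uv W (acc rs) with v ≟ y | y ≟ u | any? (etMinus? v)
  ... | yes refl | _ | _ = _ , _ , W
  ... | no _ | yes refl | _ with walk-init W
  ...   | inj₁ y≡x = contradiction (sym y≡x) x≢y
  ...   | inj₂ walk = walk
  chase x≢y uv W (acc rs) | no _ | no _ | yes (z , vz) =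
    chase x≢y vz (step W (inj₁ vz) uv<vz) (rs (∸-monoʳ-< uv<vz (lab≤B _ z)))
    where uv<vz = etMinus-increasing uv vz
  chase x≢y uv W (acc rs) | no v≢y | no y≢u | no stuck =
    _ , _ , step W (inj₂ (inj₂ (v≢y , inj₁ emitter)))
                   (A-lab-minimal (arc-into-emitter uv emitter) (≢-sym v≢y) y≢u)
    where emitter = λ w vw → stuck (w , vw)

  cover-temporalWalk : ∀ {x y} → x ≢ y → TemporalWalk {S = S} {lab} x y
  cover-temporalWalk {x} x≢y with any? (etMinus? x)
  ... | yes (z , xz) = chase x≢y xz (one (inj₁ xz) (etMinus-irreflexive xz)) (<-wellFounded _)
  ... | no stuck = _ , _ , one (inj₂ (inj₂ (x≢y , inj₁ λ w xw → stuck (w , xw)))) x≢y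

theorem2 : (n : ℕ) (lab : Labelling (suc (suc n))) →
    Symmetric lab → LocallyInjective lab →
    (A : Fin (suc (suc n)) → Fin (suc (suc n)) → Set) → IsEMinus lab A →
    TemporalSpanner lab (ForwardCover lab A)
theorem2 n lab symm linj A isE x y x≢y =
  walk⇒journey x≢y (FireworksCover.cover-temporalWalk symm linj isE x≢y)
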